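{- Let $(E,w,d)$ be a full ultra triple, let $C\subseteq E$ be a finite nonempty subset, let $m$ be a nonnegative integer, and let $k\in\{0,1,\ldots,m\}$. Let $\mathbf{a}$ be any $k$-subsequence of $C$ with maximum perimeter among all $k$-subsequences of $C$. Then there exists a greedy $m$-subsequence $(c_1,c_2,\ldots,c_m)$ of $C$ such that $\mathbf{a}$ is a permutation of the $k$-tuple $(c_1,\ldots,c_k)$.
   Context: A full ultra triple $(E,w,d)$ consists of a set $E$, a function $w:E\to\mathbb{R}$, and a function $d:E\times E\to\mathbb{R}$ such that $d(a,b)=d(b,a)$ for all $a,b\in E$ and $d(a,b)\le\max\{d(a,c),d(b,c)\}$ for all $a,b,c\in E$. For $B\subseteq E$, an $m$-subsequence of $B$ is an $m$-tuple of (not necessarily distinct) elements of $B$. The perimeter of $\mathbf{a}=(a_1,\ldots,a_m)\in E^m$ is $\operatorname{PER}(\mathbf{a})=\sum_{k=1}^m w(a_k)+\sum_{1\le i<j\le m}d(a_i,a_j)$. A greedy $m$-subsequence of $C$ is an $m$-subsequence $(c_1,\ldots,c_m)$ of $C$ such that for each $i\in\{1,\ldots,m\}$ and each $x\in C$, $\operatorname{PER}(c_1,\ldots,c_i)\ge\operatorname{PER}(c_1,\ldots,c_{i-1},x)$. -}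

module Defs where

open import Level using (Level; suc; _⊔_)
open import Data.Nat using (ℕ; _<_)
open import Data.Sum using (_⊎_)
open import Data.List using (List; []; _∷_; _++_; [_]; length; take)
open import Data.List.Membership.Propositional using (_∈_)
open import Data.List.Relation.Unary.All using (All)
open import Relation.Binary.PropositionalEquality using (_≡_)

-- A totally ordered abelian group (with propositional equality).
-- The real numbers (ℝ, +, 0, -, ≤) are an instance; the paper's values lie in ℝ.
record OrderedAbelianGroup (c ℓ : Level) : Set (suc (c ⊔ ℓ)) where
  infixl 6 _+_
  infix 4 _≤_
  field
    Carrier   : Set c
    0#        : Carrier
    _+_       : Carrier → Carrier → Carrier
    -_        : Carrier → Carrier
    _≤_       : Carrier → Carrier → Set ℓ
    +-assoc   : ∀ x y z → (x + y) + z ≡ x + (y + z)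
    +-comm    : ∀ x y → x + y ≡ y + x
    +-identityˡ : ∀ x → 0# + x ≡ x
    -‿inverseˡ : ∀ x → (- x) + x ≡ 0#
    ≤-refl    : ∀ {x} → x ≤ x
    ≤-trans   : ∀ {x y z} → x ≤ y → y ≤ z → x ≤ z
    ≤-antisym : ∀ {x y} → x ≤ y → y ≤ x → x ≡ y
    ≤-total   : ∀ x y → x ≤ y ⊎ y ≤ x
    +-monoˡ-≤ : ∀ {x y} z → x ≤ y → x + z ≤ y + z

record FullUltraTriple {c ℓ : Level} (R : OrderedAbelianGroup c ℓ) (e : Level)
       : Set (suc e ⊔ c ⊔ ℓ) where
  open OrderedAbelianGroup R
  field
    E       : Set e
    w       : E → Carrier
    d       : E → E → Carrier
    d-sym   : ∀ a b → d a b ≡ d b a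
    d-ultra : ∀ a b c → (d a b ≤ d a c) ⊎ (d a b ≤ d b c)
  -- d a b ≤ max (d a c) (d b c) is expressed as: d a b ≤ d a c or d a b ≤ d b c.

module _ {c ℓ e : Level} {R : OrderedAbelianGroup c ℓ} (T : FullUltraTriple R e) where
  open OrderedAbelianGroup R
  open FullUltraTriple T

  dsum : E → List E → Carrier
  dsum x []       = 0#
  dsum x (y ∷ ys) = d x y + dsum x ys

  PER : List E → Carrier
  PER []       = 0#
  PER (x ∷ xs) = w x + dsum x xs + PER xs

  -- an m-subsequence of C: an m-tuple of elements of C (C given as a list of its elements)
  IsSubseq : ℕ → List E → List E → Set e
  IsSubseq m C a = length a ≡ m × All (_∈ C) a
    where open import Data.Product using (_×_)

  IsMaxPerimeter : ℕ → List E → List E → Set (e ⊔ ℓ)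
  IsMaxPerimeter k C a = IsSubseq k C a × (∀ b → IsSubseq k C b → PER b ≤ PER a)
    where open import Data.Product using (_×_)

  -- greedy m-subsequence of C: for each i ∈ {1..m} (here index i-1 < m) and x ∈ C,
  -- PER(c₁,…,c_i) ≥ PER(c₁,…,c_{i-1},x)
  IsGreedy : ℕ → List E → List E → Set (e ⊔ ℓ)
  IsGreedy m C cs = IsSubseq m C cs ×
    (∀ i → i < m → ∀ x → x ∈ C → PER (take i cs ++ [ x ]) ≤ PER (take (Data.Nat.suc i) cs))
    where open import Data.Product using (_×_)

module Submission where

-- The proof is an induction on k driven by one metric fact, the exchange
-- lemma: if |A| = |B| + 1 then some a ∈ A satisfies  Σ_{A ∖ a} d a ≤ Σ_B d a.
-- It is proved by removing a closest pair (a', b') ∈ A × B; the ultrametric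
-- inequality then forces d a a' ≤ d a b' for every a ∈ A.
--
-- Let a be a maximal (k+1)-tuple and remove the element x whose removal
-- leaves the largest perimeter, a ↭ x ∷ r.  Comparing any k-tuple b with
-- the (k+1)-tuple b ++ [y], where y is given by the exchange lemma for
-- (a, b), shows that r is a maximal k-tuple.  By induction r reorders to a
-- greedy k-tuple cs, and cs ++ [x] is greedy because a is maximal.
-- Finally every greedy k-tuple extends greedily to a greedy m-tuple.

open import Defs
open import Level using (Level)
open import Data.Nat using (ℕ; _≤_)
open import Data.List using (List; take)
open import Data.List.Relation.Binary.Permutation.Propositional using (_↭_)
open import Data.Product using (Σ; _×_)
open import Data.List.Membership.Propositional using (_∈_)

open import Function using (id; _$_)
open import Data.Nat as ℕ using (zero; suc; _<_; _∸_; s≤s)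
import Data.Nat.Properties as ℕ
open import Data.List using ([]; _∷_; _++_; [_]; length; map)
open import Data.List.Properties using (length-++; take-all)
open import Data.List.Relation.Binary.Permutation.Propositional
  using (refl; prep; swap; trans; ↭-sym)
open import Data.List.Relation.Binary.Permutation.Propositional.Properties
  using (∈-resp-↭; ↭-length; All-resp-↭; drop-∷; ∷↭∷ʳ)
open import Data.List.Membership.Propositional.Properties
  using (∈-map⁺; ∈-map⁻; ∈-cartesianProduct⁺; ∈-cartesianProduct⁻)
open import Data.List.Relation.Unary.All as All using (All; []; _∷_)
open import Data.List.Relation.Unary.All.Properties using (++⁺)
open import Data.List.Relation.Unary.Any using (here; there)
open import Data.Product using (_,_; proj₁; proj₂; uncurry)
open import Data.Sum using (inj₁; inj₂)
open import Relation.Binary.PropositionalEquality as ≡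
  using (_≡_; cong; cong₂; subst; subst₂; sym)
open import Relation.Binary.Bundles using (TotalOrder)
open import Algebra.Bundles using (CommutativeMonoid)

take-++ˡ : ∀ {a} {A : Set a} n {xs ys : List A} → n ≤ length xs →
           take n (xs ++ ys) ≡ take n xs
take-++ˡ zero    _                 = ≡.refl
take-++ˡ (suc n) {x ∷ xs} (s≤s n≤) = cong (x ∷_) (take-++ˡ n n≤)

length-∷ʳ : ∀ {a} {A : Set a} (xs : List A) x → length (xs ++ [ x ]) ≡ suc (length xs)
length-∷ʳ xs x = ≡.trans (length-++ xs) (ℕ.+-comm (length xs) 1)

module OrderedGroupFacts {c ℓ : Level} (R : OrderedAbelianGroup c ℓ) where
  open OrderedAbelianGroup R public renaming (_≤_ to _⊑_)

  ≤-reflexive : ∀ {x y} → x ≡ y → x ⊑ y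
  ≤-reflexive ≡.refl = ≤-refl

  totalOrder : TotalOrder c c ℓ
  totalOrder = record
    { Carrier = Carrier ; _≈_ = _≡_ ; _≤_ = _⊑_
    ; isTotalOrder = record
      { isPartialOrder = record
        { isPreorder = record
          { isEquivalence = ≡.isEquivalence ; reflexive = ≤-reflexive ; trans = ≤-trans }
        ; antisym = ≤-antisym }
      ; total = ≤-total } }

  +-identityʳ : ∀ x → x + 0# ≡ x
  +-identityʳ x = ≡.trans (+-comm x 0#) (+-identityˡ x)

  commutativeMonoid : CommutativeMonoid c c
  commutativeMonoid = record
    { Carrier = Carrier ; _≈_ = _≡_ ; _∙_ = _+_ ; ε = 0#
    ; isCommutativeMonoid = record
      { isMonoid = record
        { isSemigroup = record
          { isMagma = record { isEquivalence = ≡.isEquivalence ; ∙-cong = cong₂ _+_ }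
          ; assoc = +-assoc }
        ; identity = +-identityˡ , +-identityʳ }
      ; comm = +-comm } }

  +-monoʳ-≤ : ∀ z {x y} → x ⊑ y → z + x ⊑ z + y
  +-monoʳ-≤ z {x} {y} x≤y = subst₂ _⊑_ (+-comm x z) (+-comm y z) (+-monoˡ-≤ z x≤y)

  +-cancelˡ-≤ : ∀ u {p q} → u + p ⊑ u + q → p ⊑ q
  +-cancelˡ-≤ u {p} {q} h = subst₂ _⊑_ (cancel p) (cancel q) (+-monoˡ-≤ (- u) h)
    where
    cancel : ∀ p → (u + p) + - u ≡ p
    open ≡.≡-Reasoning
    cancel p = begin
      (u + p) + - u  ≡⟨ cong (_+ - u) (+-comm u p) ⟩
      (p + u) + - u  ≡⟨ +-assoc p u (- u) ⟩
      p + (u + - u)  ≡⟨ cong (p +_) (≡.trans (+-comm u (- u)) (-‿inverseˡ u)) ⟩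
      p + 0#         ≡⟨ +-identityʳ p ⟩
      p              ∎

  open import Data.List.Extrema totalOrder
    using (argmax; argmin; argmax-all; argmin-all; f[xs]≤f[argmax]; f[argmin]≤f[xs])

  maximiser : ∀ {a} {A : Set a} (f : A → Carrier) {x₀ : A} {xs : List A} → x₀ ∈ xs →
              Σ A λ x → x ∈ xs × (∀ {y} → y ∈ xs → f y ⊑ f x)
  maximiser f {x₀} {xs} x₀∈ =
    argmax f x₀ xs , argmax-all f x₀∈ (All.tabulate id) , All.lookup (f[xs]≤f[argmax] x₀ xs)

  minimiser : ∀ {a} {A : Set a} (f : A → Carrier) {x₀ : A} {xs : List A} → x₀ ∈ xs →
              Σ A λ x → x ∈ xs × (∀ {y} → y ∈ xs → f x ⊑ f y)
  minimiser f {x₀} {xs} x₀∈ =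
    argmin f x₀ xs , argmin-all f x₀∈ (All.tabulate id) , All.lookup (f[argmin]≤f[xs] x₀ xs)

splits : ∀ {a} {A : Set a} → List A → List (A × List A)
splits []       = []
splits (x ∷ xs) = (x , xs) ∷ map (λ (y , r) → y , x ∷ r) (splits xs)

splits-sound : ∀ {a} {A : Set a} {y : A} {r} xs → (y , r) ∈ splits xs → xs ↭ y ∷ r
splits-sound (x ∷ xs) (here ≡.refl) = refl
splits-sound (x ∷ xs) (there s∈) with ∈-map⁻ (λ (y , r) → y , x ∷ r) s∈
... | _ , s∈′ , ≡.refl = trans (prep x (splits-sound xs s∈′)) (swap x _ refl)

splits-complete : ∀ {a} {A : Set a} {y : A} {xs} → y ∈ xs → Σ (List A) λ r → (y , r) ∈ splits xs
splits-complete {xs = x ∷ xs} (here ≡.refl) = xs , here ≡.refl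
splits-complete {xs = x ∷ xs} (there y∈) with splits-complete y∈
... | r , s∈ = x ∷ r , there (∈-map⁺ (λ (y , r) → y , x ∷ r) s∈)

remove : ∀ {a} {A : Set a} {y : A} {xs} → y ∈ xs → Σ (List A) λ r → xs ↭ y ∷ r
remove y∈ with splits-complete y∈
... | r , s∈ = r , splits-sound _ s∈

module UltraTriple {c ℓ e : Level} (R : OrderedAbelianGroup c ℓ) (T : FullUltraTriple R e) where
  open OrderedGroupFacts R
  open FullUltraTriple T
  open import Algebra.Solver.CommutativeMonoid commutativeMonoid using (solve; _⊜_; _⊕_)
  open import Relation.Binary.Reasoning.PartialOrder (TotalOrder.poset totalOrder)

  D : E → List E → Carrier
  D = dsum T

  P : List E → Carrier
  P = PER T

  dsum-resp-↭ : ∀ x {xs ys} → xs ↭ ys → D x xs ≡ D x ys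
  dsum-resp-↭ x refl        = ≡.refl
  dsum-resp-↭ x (prep y p)  = cong (d x y +_) (dsum-resp-↭ x p)
  dsum-resp-↭ x (trans p q) = ≡.trans (dsum-resp-↭ x p) (dsum-resp-↭ x q)
  dsum-resp-↭ x (swap {_} {ys} y z p) =
    ≡.trans (cong (λ t → d x y + (d x z + t)) (dsum-resp-↭ x p))
            (solve 3 (λ a b s → a ⊕ (b ⊕ s) ⊜ b ⊕ (a ⊕ s)) ≡.refl (d x y) (d x z) (D x ys))

  PER-resp-↭ : ∀ {xs ys} → xs ↭ ys → P xs ≡ P ys
  PER-resp-↭ refl        = ≡.refl
  PER-resp-↭ (prep y p)  = cong₂ (λ s t → w y + s + t) (dsum-resp-↭ y p) (PER-resp-↭ p)
  PER-resp-↭ (trans p q) = ≡.trans (PER-resp-↭ p) (PER-resp-↭ q)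
  PER-resp-↭ (swap {_} {ys} a b p)
    rewrite dsum-resp-↭ a p | dsum-resp-↭ b p | PER-resp-↭ p | d-sym a b =
    solve 6 (λ wa wb dd da db pp →
               (wa ⊕ (dd ⊕ da)) ⊕ ((wb ⊕ db) ⊕ pp) ⊜ (wb ⊕ (dd ⊕ db)) ⊕ ((wa ⊕ da) ⊕ pp))
      ≡.refl (w a) (w b) (d b a) (D a ys) (D b ys) (P ys)

  PER-∷ʳ : ∀ xs x → P (xs ++ [ x ]) ≡ w x + D x xs + P xs
  PER-∷ʳ xs x = sym (PER-resp-↭ (∷↭∷ʳ x xs))

  closest-pair : ∀ {a₀ b₀ A B} → a₀ ∈ A → b₀ ∈ B →
    Σ (E × E) λ (a' , b') → a' ∈ A × b' ∈ B × (∀ {x y} → x ∈ A → y ∈ B → d a' b' ⊑ d x y)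
  closest-pair {A = A} {B} a₀∈ b₀∈
    with minimiser (uncurry d) (∈-cartesianProduct⁺ a₀∈ b₀∈)
  ... | p , p∈ , min = p , proj₁ (∈-cartesianProduct⁻ A B p∈) , proj₂ (∈-cartesianProduct⁻ A B p∈)
                     , λ x∈ y∈ → min (∈-cartesianProduct⁺ x∈ y∈)

  closer-to-partner : ∀ a a' b' → d a' b' ⊑ d a b' → d a a' ⊑ d a b'
  closer-to-partner a a' b' closest with d-ultra a a' b'
  ... | inj₁ h = h
  ... | inj₂ h = ≤-trans h closest

  -- Exchange lemma: if |A| = |B| + 1, some a ∈ A has Σ_{A ∖ a} d a ≤ Σ_B d a.
  -- Induct on |B| after removing a closest pair (a', b').
  exchange : ∀ n (A B : List E) → length A ≡ suc n → length B ≡ n →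
             Σ E λ a → Σ (List E) λ r → (A ↭ a ∷ r) × (D a r ⊑ D a B)
  exchange zero    (x ∷ []) [] _ _ = x , [] , refl , ≤-refl
  exchange (suc n) A@(_ ∷ _) B@(_ ∷ _) |A| |B|
    with closest-pair {A = A} {B} (here ≡.refl) (here ≡.refl)
  ... | (a' , b') , a'∈ , b'∈ , closest
    with remove a'∈ | remove b'∈
  ... | A' , A↭ | B' , B↭
    with exchange n A' B' (ℕ.suc-injective (≡.trans (sym (↭-length A↭)) |A|))
                          (ℕ.suc-injective (≡.trans (sym (↭-length B↭)) |B|))
  ... | a , r , A'↭ , r≤B' = a , a' ∷ r , trans A↭ (trans (prep a' A'↭) (swap a' a refl)) , bound
    where
    a∈A : a ∈ A
    a∈A = ∈-resp-↭ (↭-sym A↭) (there (∈-resp-↭ (↭-sym A'↭) (here ≡.refl)))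
    bound : d a a' + D a r ⊑ D a B
    bound = begin
      d a a' + D a r   ≤⟨ +-monoˡ-≤ (D a r) (closer-to-partner a a' b' (closest a∈A b'∈)) ⟩
      d a b' + D a r   ≤⟨ +-monoʳ-≤ (d a b') r≤B' ⟩
      d a b' + D a B'  ≡⟨ sym (dsum-resp-↭ a B↭) ⟩
      D a B            ∎

  module _ (C : List E) where
    subseq-∷ʳ : ∀ {n xs x} → IsSubseq T n C xs → x ∈ C → IsSubseq T (suc n) C (xs ++ [ x ])
    subseq-∷ʳ {xs = xs} {x} (|xs| , xs⊆C) x∈C =
      ≡.trans (length-∷ʳ xs x) (cong suc |xs|) , ++⁺ xs⊆C (x∈C ∷ [])

    GreedyChoice : List E → E → Set (e Level.⊔ ℓ)
    GreedyChoice cs x = ∀ y → y ∈ C → P (cs ++ [ y ]) ⊑ P (cs ++ [ x ])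

    -- A greedy tuple followed by a greedy choice is again greedy: the earlier
    -- conditions only see prefixes, the new one is exactly the greedy choice.
    greedy-∷ʳ : ∀ {n cs x} → IsGreedy T n C cs → x ∈ C → GreedyChoice cs x →
                IsGreedy T (suc n) C (cs ++ [ x ])
    greedy-∷ʳ {cs = cs} {x} ((≡.refl , cs⊆C) , greedy) x∈C choice =
      subseq-∷ʳ (≡.refl , cs⊆C) x∈C , extended
      where
      extended : ∀ i → i < suc (length cs) → ∀ y → y ∈ C →
                 P (take i (cs ++ [ x ]) ++ [ y ]) ⊑ P (take (suc i) (cs ++ [ x ]))
      extended i i<1+n y y∈C with ℕ.m<1+n⇒m<n∨m≡n i<1+n
      ... | inj₁ i<n rewrite take-++ˡ i {cs} {[ x ]} (ℕ.<⇒≤ i<n) | take-++ˡ (suc i) {cs} {[ x ]} i<n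
        = greedy i i<n y y∈C
      ... | inj₂ ≡.refl
        rewrite take-++ˡ i {cs} {[ x ]} ℕ.≤-refl | take-all i cs ℕ.≤-refl
              | take-all (suc i) (cs ++ [ x ]) (ℕ.≤-reflexive (length-∷ʳ cs x))
        = choice y y∈C

    greedy-extend : ∀ {c₀} → c₀ ∈ C → ∀ j {n cs} → IsGreedy T n C cs →
                    Σ (List E) λ cs' → IsGreedy T (j ℕ.+ n) C cs' × (take n cs' ≡ cs)
    greedy-extend c₀∈ zero {cs = cs} g@((≡.refl , _) , _) = cs , g , take-all _ cs ℕ.≤-refl
    greedy-extend c₀∈ (suc j) {n} g with greedy-extend c₀∈ j g
    ... | cs' , g' , prefix with maximiser (λ x → P (cs' ++ [ x ])) c₀∈
    ... | x , x∈C , best =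
      cs' ++ [ x ] , greedy-∷ʳ g' x∈C (λ y y∈C → best y∈C) ,
      ≡.trans (take-++ˡ n (subst (n ≤_) (sym (proj₁ (proj₁ g'))) (ℕ.m≤n+m n j))) prefix

    best-deletion : ∀ x₀ xs → Σ E λ x → Σ (List E) λ r →
      (x₀ ∷ xs ↭ x ∷ r) × (∀ {y r'} → x₀ ∷ xs ↭ y ∷ r' → P r' ⊑ P r)
    best-deletion x₀ xs with maximiser (λ (_ , r) → P r) {xs = splits (x₀ ∷ xs)} (here ≡.refl)
    ... | (x , r) , s∈ , best = x , r , splits-sound _ s∈ , larger
      where
      larger : ∀ {y r'} → x₀ ∷ xs ↭ y ∷ r' → P r' ⊑ P r
      larger {r' = r'} a↭ with splits-complete (∈-resp-↭ (↭-sym a↭) (here ≡.refl))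
      ... | r'' , s∈' = begin
        P r'   ≡⟨ PER-resp-↭ (drop-∷ (trans (↭-sym a↭) (splits-sound _ s∈'))) ⟩
        P r''  ≤⟨ best s∈' ⟩
        P r    ∎

    maximal-after-deletion : ∀ {k a x r} → IsMaxPerimeter T (suc k) C a → a ↭ x ∷ r →
      (∀ {y r'} → a ↭ y ∷ r' → P r' ⊑ P r) → IsMaxPerimeter T k C r
    maximal-after-deletion {k} {a} {r = r} ((|a| , a⊆C) , maximal) a↭ largest =
      (|r| , r⊆C) , dominates
      where
      |r| : length r ≡ k
      |r| = ℕ.suc-injective (≡.trans (sym (↭-length a↭)) |a|)
      r⊆C : All (_∈ C) r
      r⊆C with All-resp-↭ a↭ a⊆C
      ... | _ ∷ r⊆C = r⊆C
      dominates : ∀ b → IsSubseq T k C b → P b ⊑ P r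
      dominates b b-sub@(|b| , _) with exchange k a b |a| |b|
      ... | y , r' , a↭′ , r'≤b with All-resp-↭ a↭′ a⊆C
      ... | y∈C ∷ _ = +-cancelˡ-≤ (w y + D y r') $ begin
        w y + D y r' + P b   ≤⟨ +-monoˡ-≤ (P b) (+-monoʳ-≤ (w y) r'≤b) ⟩
        w y + D y b + P b    ≡⟨ sym (PER-∷ʳ b y) ⟩
        P (b ++ [ y ])       ≤⟨ maximal (b ++ [ y ]) (subseq-∷ʳ b-sub y∈C) ⟩
        P a                  ≡⟨ PER-resp-↭ a↭′ ⟩
        w y + D y r' + P r'  ≤⟨ +-monoʳ-≤ (w y + D y r') (largest a↭′) ⟩
        w y + D y r' + P r   ∎

    maximal-greedy : ∀ k a → IsMaxPerimeter T k C a →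
                     Σ (List E) λ cs → IsGreedy T k C cs × (a ↭ cs)
    maximal-greedy zero    [] _ = [] , ((≡.refl , []) , λ _ ()) , refl
    maximal-greedy (suc k) a@(x₀ ∷ xs) max@((_ , a⊆C) , maximal)
      with best-deletion x₀ xs
    ... | x , r , a↭ , largest
      with maximal-greedy k r (maximal-after-deletion max a↭ largest)
    ... | cs , g@(cs-sub , _) , r↭cs with All-resp-↭ a↭ a⊆C
    ... | x∈C ∷ _ = cs ++ [ x ] , greedy-∷ʳ g x∈C choice , a↭cs
      where
      a↭cs : a ↭ cs ++ [ x ]
      a↭cs = trans a↭ (trans (prep x r↭cs) (∷↭∷ʳ x cs))
      choice : GreedyChoice cs x
      choice y y∈C = begin
        P (cs ++ [ y ])  ≤⟨ maximal (cs ++ [ y ]) (subseq-∷ʳ cs-sub y∈C) ⟩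
        P a              ≡⟨ PER-resp-↭ a↭cs ⟩
        P (cs ++ [ x ])  ∎

theorem8p7 : {c ℓ e : Level} (R : OrderedAbelianGroup c ℓ) (T : FullUltraTriple R e)
    → (C : List (FullUltraTriple.E T)) → (c₀ : FullUltraTriple.E T)
    → c₀ ∈ C
    → (m k : ℕ) → k ≤ m
    → (a : List (FullUltraTriple.E T)) → IsMaxPerimeter T k C a
    → Σ (List (FullUltraTriple.E T)) (λ cs → IsGreedy T m C cs × (a ↭ take k cs))
theorem8p7 R T C c₀ c₀∈C m k k≤m a maximal
  with UltraTriple.maximal-greedy R T C k a maximal
... | cs , greedy , a↭cs with UltraTriple.greedy-extend R T C c₀∈C (m ∸ k) greedy
... | cs' , greedy' , prefix =
  cs' , subst (λ n → IsGreedy T n C cs') (ℕ.m∸n+n≡m k≤m) greedy' , subst (a ↭_) (sym prefix) a↭cs
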